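{- Let $G$ be a cubic graph on $n \ge 8$ vertices that has a self-identifying code. If $x \in V(G)$ is not adjacent to a triangle not containing itself, then there exists $y \in B_2(x)$ such that $V(G) \setminus \{y\}$ is a self-identifying code of $G$.
   Context: All graphs are finite, simple, undirected and connected; a cubic graph is 3-regular. $N[v] = N(v) \cup \{v\}$ is the closed neighborhood; $N_S[v] = N[v] \cap S$. A set $S \subseteq V(G)$ is a self-identifying code (SIC) if for every $x \in V(G)$, $N_S[x] \neq \varnothing$ and $\bigcap_{v \in N_S[x]} N[v] = \{x\}$. $B_2(x) = \{v : d(x,v) \le 2\}$. A vertex $v$ is adjacent to a triangle not containing itself if there are vertices $a,b,c$ forming a triangle with $v \notin \{a,b,c\}$ and $va \in E(G)$. -}

module Defs where

open import Data.Nat using (ℕ; suc)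
open import Data.Fin using (Fin)
open import Data.Product using (Σ; ∃; _×_; _,_)
open import Data.Sum using (_⊎_)
open import Data.Empty using (⊥)
open import Relation.Nullary using (¬_)
open import Relation.Binary.PropositionalEquality using (_≡_)

record Graph (n : ℕ) : Set₁ where
  field
    Adj   : Fin n → Fin n → Set
    sym   : ∀ {u v} → Adj u v → Adj v u
    irrefl : ∀ {v} → ¬ Adj v v

open Graph public

data Reach {n : ℕ} (G : Graph n) : Fin n → Fin n → Set where
  here : ∀ {u} → Reach G u u
  step : ∀ {u v w} → Adj G u v → Reach G v w → Reach G u w

Connected : ∀ {n} → Graph n → Set
Connected G = ∀ u v → Reach G u v

Cubic : ∀ {n} → Graph n → Set
Cubic {n} G = ∀ v → Σ (Fin n) λ a → Σ (Fin n) λ b → Σ (Fin n) λ c →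
  (¬ a ≡ b) × (¬ a ≡ c) × (¬ b ≡ c) ×
  (∀ w → Adj G v w → (w ≡ a ⊎ w ≡ b ⊎ w ≡ c)) ×
  Adj G v a × Adj G v b × Adj G v c

N[_∣_] : ∀ {n} → Graph n → Fin n → Fin n → Set
N[ G ∣ v ] w = w ≡ v ⊎ Adj G v w

Subset : ℕ → Set₁
Subset n = Fin n → Set

-- S is a self-identifying code: for every x, N_S[x] ≠ ∅ and
-- ⋂_{v ∈ N_S[x]} N[v] = {x}.  (x always lies in that intersection,
-- so the intersection condition says every y in it equals x.)
IsSIC : ∀ {n} → Graph n → Subset n → Set
IsSIC {n} G S = ∀ x →
  (∃ λ v → S v × N[ G ∣ x ] v) ×
  (∀ y → (∀ v → S v → N[ G ∣ x ] v → N[ G ∣ v ] y) → y ≡ x)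

HasSIC : ∀ {n} → Graph n → Set₁
HasSIC {n} G = Σ (Subset n) λ S → IsSIC G S

AllBut : ∀ {n} → Fin n → Subset n
AllBut y v = ¬ v ≡ y

B₂ : ∀ {n} → Graph n → Fin n → Fin n → Set
B₂ {n} G x v = v ≡ x ⊎ Adj G x v ⊎ (∃ λ w → Adj G x w × Adj G w v)

AdjToTriangle : ∀ {n} → Graph n → Fin n → Set
AdjToTriangle {n} G v = Σ (Fin n) λ a → Σ (Fin n) λ b → Σ (Fin n) λ c →
  Adj G a b × Adj G b c × Adj G a c ×
  (¬ v ≡ a) × (¬ v ≡ b) × (¬ v ≡ c) × Adj G v a

-- A graph with a self-identifying code is separated: for u ≠ z some k ∈ N[u] has z ∉ N[k].
-- In a separated cubic graph, V ∖ {y} is again a self-identifying code as soon as y is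
-- neither adjacent to a triangle avoiding it nor has an open twin (a t ≠ y with
-- N(t) = N(y)).  So y = x works unless x has a twin w.  In that case the neighbours of x
-- lie in no triangle, and each neighbour u either is adjacent to a triangle, whose vertex
-- next to u is then a good choice at distance 2 from x, or is itself good, or has a twin.
-- If all three neighbours of x have twins, they share one neighbourhood and the connected
-- graph is K₃,₃, contradicting n ≥ 8.
module Submission where

open import Defs hiding (sym)
open import Data.Nat using (ℕ; _≤_)
open import Data.Nat.Properties using (≤⇒≯; <⇒≤)
open import Data.Fin using (Fin; zero; suc)
open import Data.Fin.Properties using (_≟_; any?; injective⇒≤)
open import Data.Vec using ([]; _∷_; lookup)
open import Data.Product using (∃; _×_; _,_; proj₁; proj₂)
open import Data.Sum using (_⊎_; inj₁; inj₂)
open import Data.Empty using (⊥; ⊥-elim)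
open import Function.Definitions using (StrictlySurjective)
open import Relation.Nullary using (¬_; Dec; yes; no)
open import Relation.Nullary.Decidable using (¬?; _×-dec_)
open import Relation.Binary.PropositionalEquality using (_≡_; _≢_; refl; sym; trans; cong; ≢-sym)

strictlySurjective⇒≤ : ∀ {m n} {e : Fin m → Fin n} → StrictlySurjective _≡_ e → n ≤ m
strictlySurjective⇒≤ {e = e} surj = injective⇒≤ section-injective
  where
  section-injective : ∀ {u v} → proj₁ (surj u) ≡ proj₁ (surj v) → u ≡ v
  section-injective {u} {v} eq =
    trans (sym (proj₂ (surj u))) (trans (cong e eq) (proj₂ (surj v)))

OneOf₂ : ∀ {n} → Fin n → Fin n → Fin n → Set
OneOf₂ w a b = w ≡ a ⊎ w ≡ b

OneOf₃ : ∀ {n} → Fin n → Fin n → Fin n → Fin n → Set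
OneOf₃ w a b c = w ≡ a ⊎ w ≡ b ⊎ w ≡ c

oneOf₂-pigeonhole : ∀ {n} {a b q r s : Fin n} → OneOf₂ q a b → OneOf₂ r a b → OneOf₂ s a b →
  q ≢ r → q ≢ s → r ≢ s → ⊥
oneOf₂-pigeonhole (inj₁ refl) (inj₁ refl) _           q≢r _   _   = q≢r refl
oneOf₂-pigeonhole (inj₁ refl) (inj₂ refl) (inj₁ refl) _   q≢s _   = q≢s refl
oneOf₂-pigeonhole (inj₁ refl) (inj₂ refl) (inj₂ refl) _   _   r≢s = r≢s refl
oneOf₂-pigeonhole (inj₂ refl) (inj₁ refl) (inj₁ refl) _   _   r≢s = r≢s refl
oneOf₂-pigeonhole (inj₂ refl) (inj₁ refl) (inj₂ refl) _   q≢s _   = q≢s refl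
oneOf₂-pigeonhole (inj₂ refl) (inj₂ refl) _           q≢r _   _   = q≢r refl

oneOf₂⊎avoids : ∀ {n} (w y z : Fin n) → OneOf₂ w y z ⊎ (w ≢ y × w ≢ z)
oneOf₂⊎avoids w y z with w ≟ y | w ≟ z
... | yes w≡y | _       = inj₁ (inj₁ w≡y)
... | no  _   | yes w≡z = inj₁ (inj₂ w≡z)
... | no  w≢y | no  w≢z = inj₂ (w≢y , w≢z)

module _ {n : ℕ} {a b c : Fin n} where

  oneOf₃-without₁ : ∀ {t} → OneOf₃ t a b c → a ≢ t → OneOf₂ t b c
  oneOf₃-without₁ (inj₁ refl) a≢t = ⊥-elim (a≢t refl)
  oneOf₃-without₁ (inj₂ t∈bc) _   = t∈bc

  oneOf₃-without₂ : ∀ {t} → OneOf₃ t a b c → b ≢ t → OneOf₂ t a c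
  oneOf₃-without₂ (inj₁ t≡a)         _   = inj₁ t≡a
  oneOf₃-without₂ (inj₂ (inj₁ refl)) b≢t = ⊥-elim (b≢t refl)
  oneOf₃-without₂ (inj₂ (inj₂ t≡c))  _   = inj₂ t≡c

  oneOf₃-without₃ : ∀ {t} → OneOf₃ t a b c → c ≢ t → OneOf₂ t a b
  oneOf₃-without₃ (inj₁ t≡a)         _   = inj₁ t≡a
  oneOf₃-without₃ (inj₂ (inj₁ t≡b))  _   = inj₂ t≡b
  oneOf₃-without₃ (inj₂ (inj₂ refl)) c≢t = ⊥-elim (c≢t refl)

  oneOf₃-pigeonhole : ∀ {p q r s} →
    OneOf₃ p a b c → OneOf₃ q a b c → OneOf₃ r a b c → OneOf₃ s a b c →
    p ≢ q → p ≢ r → p ≢ s → q ≢ r → q ≢ s → r ≢ s → ⊥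
  oneOf₃-pigeonhole (inj₁ refl) hq hr hs p≢q p≢r p≢s = oneOf₂-pigeonhole
    (oneOf₃-without₁ hq p≢q) (oneOf₃-without₁ hr p≢r) (oneOf₃-without₁ hs p≢s)
  oneOf₃-pigeonhole (inj₂ (inj₁ refl)) hq hr hs p≢q p≢r p≢s = oneOf₂-pigeonhole
    (oneOf₃-without₂ hq p≢q) (oneOf₃-without₂ hr p≢r) (oneOf₃-without₂ hs p≢s)
  oneOf₃-pigeonhole (inj₂ (inj₂ refl)) hq hr hs p≢q p≢r p≢s = oneOf₂-pigeonhole
    (oneOf₃-without₃ hq p≢q) (oneOf₃-without₃ hr p≢r) (oneOf₃-without₃ hs p≢s)

  oneOf₃-avoiding : a ≢ b → a ≢ c → b ≢ c → (y z : Fin n) →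
    ∃ λ r → OneOf₃ r a b c × r ≢ y × r ≢ z
  oneOf₃-avoiding a≢b a≢c b≢c y z
    with oneOf₂⊎avoids a y z | oneOf₂⊎avoids b y z | oneOf₂⊎avoids c y z
  ... | inj₂ (a≢y , a≢z) | _ | _ = a , inj₁ refl , a≢y , a≢z
  ... | inj₁ _ | inj₂ (b≢y , b≢z) | _ = b , inj₂ (inj₁ refl) , b≢y , b≢z
  ... | inj₁ _ | inj₁ _ | inj₂ (c≢y , c≢z) = c , inj₂ (inj₂ refl) , c≢y , c≢z
  ... | inj₁ a∈yz | inj₁ b∈yz | inj₁ c∈yz =
    ⊥-elim (oneOf₂-pigeonhole a∈yz b∈yz c∈yz a≢b a≢c b≢c)

reach-closed : ∀ {n} (G : Graph n) (P : Fin n → Set) →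
  (∀ {u k} → P u → Adj G u k → P k) → ∀ {u v} → Reach G u v → P u → P v
reach-closed G P closed here           Pu = Pu
reach-closed G P closed (step u~k k⇝v) Pu = reach-closed G P closed k⇝v (closed Pu u~k)

module CubicGraph {n : ℕ} (G : Graph n) (cubic : Cubic G) where

  infix 4 _~_ _~?_ _⊆ᴺ_

  _~_ : Fin n → Fin n → Set
  u ~ v = Adj G u v

  ~-sym : ∀ {u v} → u ~ v → v ~ u
  ~-sym = Graph.sym G

  ~⇒≢ : ∀ {u v} → u ~ v → u ≢ v
  ~⇒≢ u~u refl = irrefl G u~u

  _~?_ : ∀ u w → Dec (u ~ w)
  u ~? w with cubic u
  ... | a , b , c , _ , _ , _ , nbr , u~a , u~b , u~c with w ≟ a | w ≟ b | w ≟ c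
  ... | yes refl | _        | _        = yes u~a
  ... | no  _    | yes refl | _        = yes u~b
  ... | no  _    | no  _    | yes refl = yes u~c
  ... | no  w≢a  | no  w≢b  | no  w≢c  = no λ u~w → excluded (nbr w u~w)
    where
    excluded : ¬ OneOf₃ w a b c
    excluded (inj₁ w≡a)        = w≢a w≡a
    excluded (inj₂ (inj₁ w≡b)) = w≢b w≡b
    excluded (inj₂ (inj₂ w≡c)) = w≢c w≡c

  N? : ∀ k z → Dec (N[ G ∣ k ] z)
  N? k z with z ≟ k | k ~? z
  ... | yes z≡k | _        = yes (inj₁ z≡k)
  ... | no  _   | yes k~z  = yes (inj₂ k~z)
  ... | no  z≢k | no  k≁z  = no λ { (inj₁ z≡k) → z≢k z≡k ; (inj₂ k~z) → k≁z k~z }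

  ¬four-neighbours : ∀ {u p q r s} → u ~ p → u ~ q → u ~ r → u ~ s →
    p ≢ q → p ≢ r → p ≢ s → q ≢ r → q ≢ s → r ≢ s → ⊥
  ¬four-neighbours {u} {p} {q} {r} {s} u~p u~q u~r u~s with cubic u
  ... | _ , _ , _ , _ , _ , _ , nbr , _ =
    oneOf₃-pigeonhole (nbr p u~p) (nbr q u~q) (nbr r u~r) (nbr s u~s)

  neighbour-oneOf : ∀ {u v s t w} → u ~ v → u ~ s → u ~ t → v ≢ s → v ≢ t → s ≢ t →
    u ~ w → OneOf₃ w v s t
  neighbour-oneOf {v = v} {s} {t} {w} u~v u~s u~t v≢s v≢t s≢t u~w with w ≟ v | w ≟ s | w ≟ t
  ... | yes w≡v | _       | _       = inj₁ w≡v
  ... | no  _   | yes w≡s | _       = inj₂ (inj₁ w≡s)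
  ... | no  _   | no  _   | yes w≡t = inj₂ (inj₂ w≡t)
  ... | no  w≢v | no  w≢s | no  w≢t = ⊥-elim (¬four-neighbours u~v u~s u~t u~w
        v≢s v≢t (≢-sym w≢v) s≢t (≢-sym w≢s) (≢-sym w≢t))

  ~-oneOf₃ : ∀ {u a b c t} → u ~ a → u ~ b → u ~ c → OneOf₃ t a b c → u ~ t
  ~-oneOf₃ u~a _   _   (inj₁ refl)        = u~a
  ~-oneOf₃ _   u~b _   (inj₂ (inj₁ refl)) = u~b
  ~-oneOf₃ _   _   u~c (inj₂ (inj₂ refl)) = u~c

  ∀-nbrs-⊎ : ∀ {R : Set} {P : Fin n → Set} {x} →
    (∀ u → x ~ u → R ⊎ P u) → R ⊎ (∀ u → x ~ u → P u)
  ∀-nbrs-⊎ {P = P} {x} choice with cubic x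
  ... | a , b , c , _ , _ , _ , nbr , x~a , x~b , x~c
    with choice a x~a | choice b x~b | choice c x~c
  ... | inj₁ r  | _      | _      = inj₁ r
  ... | inj₂ _  | inj₁ r | _      = inj₁ r
  ... | inj₂ _  | inj₂ _ | inj₁ r = inj₁ r
  ... | inj₂ Pa | inj₂ Pb | inj₂ Pc = inj₂ λ u x~u → P-oneOf (nbr u x~u)
    where
    P-oneOf : ∀ {u} → OneOf₃ u a b c → P u
    P-oneOf (inj₁ refl)        = Pa
    P-oneOf (inj₂ (inj₁ refl)) = Pb
    P-oneOf (inj₂ (inj₂ refl)) = Pc

  Separates : Fin n → Fin n → Set
  Separates u z = ∃ λ k → N[ G ∣ u ] k × ¬ N[ G ∣ k ] z

  Separated : Set
  Separated = ∀ {u z} → u ≢ z → Separates u z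

  hasSIC⇒separated : HasSIC G → Separated
  hasSIC⇒separated (S , isSIC) {u} {z} u≢z with cubic u
  ... | a , b , c , _ , _ , _ , nbr , u~a , u~b , u~c
    with N? u z | N? a z | N? b z | N? c z
  ... | no z∉N[u] | _         | _         | _         = u , inj₁ refl , z∉N[u]
  ... | yes _     | no z∉N[a] | _         | _         = a , inj₂ u~a , z∉N[a]
  ... | yes _     | yes _     | no z∉N[b] | _         = b , inj₂ u~b , z∉N[b]
  ... | yes _     | yes _     | yes _     | no z∉N[c] = c , inj₂ u~c , z∉N[c]
  ... | yes z∈N[u] | yes z∈N[a] | yes z∈N[b] | yes z∈N[c] =
    ⊥-elim (u≢z (sym (proj₂ (isSIC u) z z∈⋂N[v])))
    where
    z∈⋂N[v] : ∀ v → S v → N[ G ∣ u ] v → N[ G ∣ v ] z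
    z∈⋂N[v] v _ (inj₁ refl) = z∈N[u]
    z∈⋂N[v] v _ (inj₂ u~v) with nbr v u~v
    ... | inj₁ refl        = z∈N[a]
    ... | inj₂ (inj₁ refl) = z∈N[b]
    ... | inj₂ (inj₂ refl) = z∈N[c]

  no-diamond : Separated → ∀ {u v s t} → u ~ v → u ~ s → v ~ s → u ~ t → v ~ t → s ≢ t → ⊥
  no-diamond separated u~v u~s v~s u~t v~t s≢t with separated (~⇒≢ u~v)
  ... | _ , inj₁ refl , v∉N[u] = v∉N[u] (inj₂ u~v)
  ... | _ , inj₂ u~k  , v∉N[k]
    with neighbour-oneOf u~v u~s u~t (~⇒≢ v~s) (~⇒≢ v~t) s≢t u~k
  ... | inj₁ refl        = v∉N[k] (inj₁ refl)
  ... | inj₂ (inj₁ refl) = v∉N[k] (inj₂ (~-sym v~s))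
  ... | inj₂ (inj₂ refl) = v∉N[k] (inj₂ (~-sym v~t))

  _⊆ᴺ_ : Fin n → Fin n → Set
  u ⊆ᴺ t = ∀ k → u ~ k → t ~ k

  ⊆ᴺ-trans : ∀ {u v t} → u ⊆ᴺ v → v ⊆ᴺ t → u ⊆ᴺ t
  ⊆ᴺ-trans u⊆v v⊆t k u~k = v⊆t k (u⊆v k u~k)

  ⊆ᴺ-sym : ∀ {u t} → u ⊆ᴺ t → t ⊆ᴺ u
  ⊆ᴺ-sym {u} u⊆t k t~k with cubic u
  ... | a , b , c , a≢b , a≢c , b≢c , _ , u~a , u~b , u~c
    with neighbour-oneOf (u⊆t a u~a) (u⊆t b u~b) (u⊆t c u~c) a≢b a≢c b≢c t~k
  ... | inj₁ refl        = u~a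
  ... | inj₂ (inj₁ refl) = u~b
  ... | inj₂ (inj₂ refl) = u~c

  HasTwin : Fin n → Set
  HasTwin u = ∃ λ t → u ≢ t × u ⊆ᴺ t

  hasTwin? : ∀ u → Dec (HasTwin u)
  hasTwin? u with cubic u
  ... | a , b , c , _ , _ , _ , nbr , u~a , u~b , u~c
    with any? (λ t → ¬? (u ≟ t) ×-dec t ~? a ×-dec t ~? b ×-dec t ~? c)
  ... | no  ¬twin =
    no λ (t , u≢t , u⊆t) → ¬twin (t , u≢t , u⊆t a u~a , u⊆t b u~b , u⊆t c u~c)
  ... | yes (t , u≢t , t~a , t~b , t~c) = yes (t , u≢t , u⊆t)
    where
    u⊆t : u ⊆ᴺ t
    u⊆t k u~k with nbr k u~k
    ... | inj₁ refl        = t~a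
    ... | inj₂ (inj₁ refl) = t~b
    ... | inj₂ (inj₂ refl) = t~c

  adjToTriangle? : ∀ u → Dec (AdjToTriangle G u)
  adjToTriangle? u = any? λ a → any? λ b → any? λ c →
    a ~? b ×-dec b ~? c ×-dec a ~? c ×-dec ¬? (u ≟ a) ×-dec ¬? (u ≟ b) ×-dec ¬? (u ≟ c)
      ×-dec u ~? a

  Good : Fin n → Set
  Good y = ¬ AdjToTriangle G y × ¬ HasTwin y

  Indistinguishable : Fin n → Fin n → Fin n → Set
  Indistinguishable y x z = ∀ v → AllBut y v → N[ G ∣ x ] v → N[ G ∣ v ] z

  allBut-dominating : ∀ y x → ∃ λ v → AllBut y v × N[ G ∣ x ] v
  allBut-dominating y x with x ≟ y | cubic x
  ... | no  x≢y  | _ = x , x≢y , inj₁ refl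
  ... | yes refl | a , _ , _ , _ , _ , _ , _ , x~a , _ = a , ≢-sym (~⇒≢ x~a) , inj₂ x~a

  indistinguishable⇒⊆ᴺ : ∀ {x z} → ¬ N[ G ∣ x ] z → Indistinguishable x x z → x ⊆ᴺ z
  indistinguishable⇒⊆ᴺ z∉N[x] indist k x~k with indist k (≢-sym (~⇒≢ x~k)) (inj₂ x~k)
  ... | inj₁ refl = ⊥-elim (z∉N[x] (inj₂ x~k))
  ... | inj₂ k~z  = ~-sym k~z

  indistinguishable⇒adjToTriangle : ∀ {x y z} → x ~ y → ¬ N[ G ∣ y ] z → z ≢ x →
    Indistinguishable y x z → AdjToTriangle G y
  indistinguishable⇒adjToTriangle {x} {y} {z} x~y z∉N[y] z≢x indist
    with indist x (~⇒≢ x~y) (inj₁ refl)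
  ... | inj₁ z≡x = ⊥-elim (z≢x z≡x)
  ... | inj₂ x~z with cubic x
  ... | a , b , c , a≢b , a≢c , b≢c , _ , x~a , x~b , x~c with oneOf₃-avoiding a≢b a≢c b≢c y z
  ... | r , r∈abc , r≢y , r≢z =
    x , z , r , x~z , z~r , x~r , ~⇒≢ (~-sym x~y) , (λ y≡z → z∉N[y] (inj₁ (sym y≡z))) ,
    ≢-sym r≢y , ~-sym x~y
    where
    x~r : x ~ r
    x~r = ~-oneOf₃ x~a x~b x~c r∈abc
    z~r : z ~ r
    z~r with indist r r≢y (inj₂ x~r)
    ... | inj₁ z≡r = ⊥-elim (r≢z (sym z≡r))
    ... | inj₂ r~z = ~-sym r~z

  -- If the separating vertex k of x and z is y itself, then either y = x and z is a twin
  -- of y, or y ~ x and y is adjacent to a triangle through x and z.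
  good⇒isSIC-allBut : Separated → ∀ {y} → Good y → IsSIC G (AllBut y)
  good⇒isSIC-allBut separated {y} (noTri , noTwin) x = allBut-dominating y x , identified
    where
    identified : ∀ z → Indistinguishable y x z → z ≡ x
    identified z indist with z ≟ x
    ... | yes z≡x = z≡x
    ... | no  z≢x with separated (≢-sym z≢x)
    ... | k , k∈N[x] , z∉N[k] with k ≟ y
    ... | no  k≢y = ⊥-elim (z∉N[k] (indist k k≢y k∈N[x]))
    ... | yes refl with k∈N[x]
    ... | inj₁ refl = ⊥-elim (noTwin (z , ≢-sym z≢x , indistinguishable⇒⊆ᴺ z∉N[k] indist))
    ... | inj₂ x~k  = ⊥-elim (noTri (indistinguishable⇒adjToTriangle x~k z∉N[k] z≢x indist))

  InNoTriangle : Fin n → Set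
  InNoTriangle u = ∀ {s t} → u ~ s → u ~ t → ¬ s ~ t

  no-second-triangle : Separated → ∀ {p q r q₁ r₁} → p ~ q → p ~ r → q ~ r →
    q ~ q₁ → q ~ r₁ → q₁ ~ r₁ → p ≢ q₁ → p ≢ r₁ → ⊥
  no-second-triangle separated {r = r} {q₁ = q₁} {r₁ = r₁} p~q p~r q~r q~q₁ q~r₁ q₁~r₁ p≢q₁ p≢r₁
    with q₁ ≟ r | r₁ ≟ r
  ... | yes refl | _        = no-diamond separated q~r (~-sym p~q) (~-sym p~r) q~r₁ q₁~r₁ p≢r₁
  ... | no  _    | yes refl = no-diamond separated q~r (~-sym p~q) (~-sym p~r) q~q₁ (~-sym q₁~r₁) p≢q₁
  ... | no  q₁≢r | no  r₁≢r = ¬four-neighbours (~-sym p~q) q~r q~q₁ q~r₁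
    (~⇒≢ p~r) p≢q₁ p≢r₁ (≢-sym q₁≢r) (≢-sym r₁≢r) (~⇒≢ q₁~r₁)

  triangle-vertex-good : Separated → ∀ {p q r a} → p ~ q → p ~ r → q ~ r → p ~ a →
    a ≢ q → a ≢ r → InNoTriangle a → Good p
  triangle-vertex-good separated {p} {q} {r} p~q p~r q~r p~a a≢q a≢r a-noTri = noTri , noTwin
    where
    noTri : ¬ AdjToTriangle G p
    noTri (s , t , u , s~t , t~u , s~u , p≢s , p≢t , p≢u , p~s)
      with neighbour-oneOf p~a p~q p~r a≢q a≢r (~⇒≢ q~r) p~s
    ... | inj₁ refl        = a-noTri s~t s~u t~u
    ... | inj₂ (inj₁ refl) = no-second-triangle separated p~q p~r q~r s~t s~u t~u p≢t p≢u
    ... | inj₂ (inj₂ refl) = no-second-triangle separated p~r p~q (~-sym q~r) s~t s~u t~u p≢t p≢u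
    noTwin : ¬ HasTwin p
    noTwin (t , p≢t , p⊆t) =
      no-diamond separated q~r (~-sym p~q) (~-sym p~r) (~-sym (p⊆t q p~q)) (~-sym (p⊆t r p~r)) p≢t

  RemovableNear : Fin n → Set
  RemovableNear x = ∃ λ y → B₂ G x y × IsSIC G (AllBut y)

  module _ (separated : Separated) {x w : Fin n} (noTri : ¬ AdjToTriangle G x)
           (x≢w : x ≢ w) (x⊆w : x ⊆ᴺ w) where

    nbrs-nonadjacent : ∀ {u v} → x ~ u → x ~ v → ¬ u ~ v
    nbrs-nonadjacent {u} {v} x~u x~v u~v = noTri
      (u , v , w , u~v , ~-sym (x⊆w v x~v) , ~-sym (x⊆w u x~u) , ~⇒≢ x~u , ~⇒≢ x~v , x≢w , x~u)

    nbr-inNoTriangle : ∀ {u} → x ~ u → InNoTriangle u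
    nbr-inNoTriangle {u} x~u {q} {r} u~q u~r q~r with q ≟ x | q ≟ w | r ≟ x | r ≟ w
    ... | yes refl | _        | _        | _        = nbrs-nonadjacent x~u q~r u~r
    ... | no  _    | yes refl | _        | _        = nbrs-nonadjacent x~u (⊆ᴺ-sym x⊆w r q~r) u~r
    ... | no  _    | no  _    | yes refl | _        = nbrs-nonadjacent x~u (~-sym q~r) u~q
    ... | no  _    | no  _    | no  _    | yes refl =
      nbrs-nonadjacent x~u (⊆ᴺ-sym x⊆w q (~-sym q~r)) u~q
    ... | no  q≢x  | no  q≢w  | no  r≢x  | no  r≢w  =
      ¬four-neighbours (~-sym x~u) (~-sym (x⊆w u x~u)) u~q u~r
      x≢w (≢-sym q≢x) (≢-sym r≢x) (≢-sym q≢w) (≢-sym r≢w) (~⇒≢ q~r)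

    nbr-removableNear-or-twin : ∀ u → x ~ u → RemovableNear x ⊎ HasTwin u
    nbr-removableNear-or-twin u x~u with adjToTriangle? u | hasTwin? u
    ... | yes (p , q , r , p~q , q~r , p~r , u≢p , u≢q , u≢r , u~p) | _ =
      inj₁ (p , inj₂ (inj₂ (u , x~u , u~p)) , good⇒isSIC-allBut separated
        (triangle-vertex-good separated p~q p~r q~r (~-sym u~p) u≢q u≢r (nbr-inNoTriangle x~u)))
    ... | no  uNoTri | no  uNoTwin =
      inj₁ (u , inj₂ (inj₁ x~u) , good⇒isSIC-allBut separated (uNoTri , uNoTwin))
    ... | no  _      | yes twin    = inj₂ twin

  -- Twins of the neighbours a, b, c of x lie among a, b, c, so a, b, c share one
  -- neighbourhood and N(x) ∪ N(a) is closed under adjacency.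
  twinned-nbrs⇒≤6 : Connected G → ∀ x → (∀ u → x ~ u → HasTwin u) → n ≤ 6
  twinned-nbrs⇒≤6 connected x twinned with cubic x
  ... | a , b , c , a≢b , a≢c , b≢c , nbr , x~a , x~b , x~c with cubic a
  ... | a₁ , a₂ , a₃ , _ , _ , _ , nbrᵃ , _ =
    strictlySurjective⇒≤ {e = lookup (a ∷ b ∷ c ∷ a₁ ∷ a₂ ∷ a₃ ∷ [])} covered
    where
    sibling-twin : ∀ {u} → x ~ u → HasTwin u → ∃ λ t → OneOf₃ t a b c × u ≢ t × u ⊆ᴺ t
    sibling-twin x~u (t , u≢t , u⊆t) = t , nbr t (~-sym (u⊆t x (~-sym x~u))) , u≢t , u⊆t

    b⊆a×c⊆a : b ⊆ᴺ a × c ⊆ᴺ a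
    b⊆a×c⊆a with sibling-twin x~a (twinned a x~a)
    ... | _ , inj₁ refl , a≢a , _ = ⊥-elim (a≢a refl)
    ... | _ , inj₂ (inj₁ refl) , _ , a⊆b with sibling-twin x~c (twinned c x~c)
    ...   | _ , inj₁ refl , _ , c⊆a = ⊆ᴺ-sym a⊆b , c⊆a
    ...   | _ , inj₂ (inj₁ refl) , _ , c⊆b = ⊆ᴺ-sym a⊆b , ⊆ᴺ-trans c⊆b (⊆ᴺ-sym a⊆b)
    ...   | _ , inj₂ (inj₂ refl) , c≢c , _ = ⊥-elim (c≢c refl)
    b⊆a×c⊆a | _ , inj₂ (inj₂ refl) , _ , a⊆c with sibling-twin x~b (twinned b x~b)
    ...   | _ , inj₁ refl , _ , b⊆a = b⊆a , ⊆ᴺ-sym a⊆c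
    ...   | _ , inj₂ (inj₁ refl) , b≢b , _ = ⊥-elim (b≢b refl)
    ...   | _ , inj₂ (inj₂ refl) , _ , b⊆c = ⊆ᴺ-trans b⊆c (⊆ᴺ-sym a⊆c) , ⊆ᴺ-sym a⊆c

    nbr⊆a : ∀ {u} → OneOf₃ u a b c → u ⊆ᴺ a
    nbr⊆a (inj₁ refl)        = λ _ a~k → a~k
    nbr⊆a (inj₂ (inj₁ refl)) = proj₁ b⊆a×c⊆a
    nbr⊆a (inj₂ (inj₂ refl)) = proj₂ b⊆a×c⊆a

    Near : Fin n → Set
    Near v = x ~ v ⊎ a ~ v

    closed : ∀ {u k} → Near u → u ~ k → Near k
    closed {u} (inj₁ x~u) u~k = inj₂ (nbr⊆a (nbr u x~u) _ u~k)
    closed {u} (inj₂ a~u) u~k =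
      inj₁ (~-oneOf₃ x~a x~b x~c (neighbour-oneOf u~a u~b u~c a≢b a≢c b≢c u~k))
      where
      u~a = ~-sym a~u
      u~b = ~-sym (⊆ᴺ-sym (proj₁ b⊆a×c⊆a) u a~u)
      u~c = ~-sym (⊆ᴺ-sym (proj₂ b⊆a×c⊆a) u a~u)

    covered : StrictlySurjective _≡_ (lookup (a ∷ b ∷ c ∷ a₁ ∷ a₂ ∷ a₃ ∷ []))
    covered v with reach-closed G Near closed (connected a v) (inj₁ x~a)
    ... | inj₁ x~v with nbr v x~v
    ...   | inj₁ refl        = zero , refl
    ...   | inj₂ (inj₁ refl) = suc zero , refl
    ...   | inj₂ (inj₂ refl) = suc (suc zero) , refl
    covered v | inj₂ a~v with nbrᵃ v a~v
    ...   | inj₁ refl        = suc (suc (suc zero)) , refl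
    ...   | inj₂ (inj₁ refl) = suc (suc (suc (suc zero))) , refl
    ...   | inj₂ (inj₂ refl) = suc (suc (suc (suc (suc zero)))) , refl

mainTheorem8 : ∀ (n : ℕ) (G : Graph n) → 8 ≤ n → Connected G → Cubic G →
    HasSIC G → (x : Fin n) → ¬ AdjToTriangle G x →
    ∃ λ y → B₂ G x y × IsSIC G (AllBut y)
mainTheorem8 n G 8≤n connected cubic hasSIC x noTri = removableNear
  where
  open CubicGraph G cubic
  separated = hasSIC⇒separated hasSIC
  removableNear : RemovableNear x
  removableNear with hasTwin? x
  ... | no noTwin = x , inj₁ refl , good⇒isSIC-allBut separated (noTri , noTwin)
  ... | yes (w , x≢w , x⊆w)
    with ∀-nbrs-⊎ (nbr-removableNear-or-twin separated noTri x≢w x⊆w)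
  ...   | inj₁ near    = near
  ...   | inj₂ twinned = ⊥-elim (≤⇒≯ (twinned-nbrs⇒≤6 connected x twinned) (<⇒≤ 8≤n))
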